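{- Let $t$ be a closed term. If $d \colon t \to_{\mathrm{need}}^{*} s$ and $\mathrm{normal}(s)$, then there exists a tight derivation in the CbNeed type system of $\vdash^{(|d|_m,|d|_e)} t : [\mathsf{normal}]$.
   Context: Terms: $t,s ::= x \mid \lambda x.t \mid t\,s \mid t[x\leftarrow s]$, where $t[x\leftarrow s]$ (explicit substitution) binds $x$ in $t$; values $v ::= \lambda x.t$. $\mathrm{fv}(t[x\leftarrow s])=(\mathrm{fv}(t)\setminus\{x\})\cup\mathrm{fv}(s)$; $t$ is closed if $\mathrm{fv}(t)=\emptyset$; terms are up to $\alpha$-equivalence. Contexts (one hole $\langle\cdot\rangle$): substitution contexts $S ::= \langle\cdot\rangle \mid S[x\leftarrow t]$; CbNeed contexts $E ::= \langle\cdot\rangle \mid E\,t \mid E[x\leftarrow t] \mid E\langle\langle x\rangle\rangle[x\leftarrow E']$. $E\langle t\rangle$ is plugging (may capture); $E\langle\langle t\rangle\rangle$ denotes plugging where $E$ does not capture free variables of $t$. Root steps: $S\langle\lambda x.t\rangle s \mapsto_m S\langle t[x\leftarrow s]\rangle$ (variables bound by $S$ disjoint from $\mathrm{fv}(s)$); $E\langle\langle x\rangle\rangle[x\leftarrow S\langle v\rangle] \mapsto_{e} S\langle E\langle\langle v\rangle\rangle[x\leftarrow v]\rangle$ (variables bound by $S$ disjoint from $\mathrm{fv}(E\langle\langle x\rangle\rangle)$). $\to_{m,\mathrm{need}}$ (resp. $\to_{e,\mathrm{need}}$) relates $E\langle t'\rangle$ to $E\langle s'\rangle$ for any CbNeed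 context $E$ whenever $t'\mapsto_m s'$ (resp. $t'\mapsto_e s'$); $\to_{\mathrm{need}}=\to_{m,\mathrm{need}}\cup\to_{e,\mathrm{need}}$. For an evaluation sequence $d$, $|d|_m$, $|d|_e$ are its numbers of multiplicative and exponential steps. $\mathrm{normal}$ is the least predicate with $\mathrm{normal}(\lambda x.t)$ and $\mathrm{normal}(t)\Rightarrow\mathrm{normal}(t[x\leftarrow s])$. CbNeed types: linear types $L ::= \mathsf{normal} \mid M \to N$; multi types $M,N ::= [L_i]_{i\in J}$ finite multisets, $\mathbf{0}$ the empty multiset, $\uplus$ multiset union. A type context $\Gamma$ maps variables to multi types, all but finitely many to $\mathbf 0$; $\mathrm{dom}(\Gamma)=\{x\mid\Gamma(x)\neq\mathbf 0\}$; $\Gamma$ is empty if its domain is empty; $\uplus$ extends pointwise; $\Gamma, x:M$ means $\Gamma\uplus(x\mapsto M)$ with $x\notin\mathrm{dom}(\Gamma)$. Judgements $\Gamma\vdash^{(m,e)} t : T$. Rules: (ax) $x:M \vdash^{(0,1)} x : M$ (with $M\neq\mathbf 0$); (normal) $\vdash^{(0,0)} \lambda x.t : \mathsf{normal}$; (fun) from $\Gamma, x:M \vdash^{(m,e)} t : N$ infer $\Gamma\vdash^{(m,e)} \lambda x.t : M\to N$; (many) from $\Gamma_i\vdash^{(m_i,e_i)}\lambda x.t : L_i$ for $i\in J$, $J\neq\emptyset$, infer $\biguplus_i\Gamma_i\vdash^{(\sum m_i,\sum e_i)}\lambda x.t : [L_i]_{i\in J}$; (app$_{gc}$) from $\Gamma\vdash^{(m,e)}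 t:[\mathbf 0\to M]$ infer $\Gamma\vdash^{(m+1,e)} t\,s : M$; (app) from $\Gamma\vdash^{(m,e)} t : [N\to M]$ and $\Pi\vdash^{(m',e')} s:N$ with $N\neq\mathbf 0$ infer $\Gamma\uplus\Pi\vdash^{(m+m'+1,e+e')} t\,s:M$; (ES$_{gc}$) from $\Gamma\vdash^{(m,e)} t:M$ with $\Gamma(x)=\mathbf 0$ infer $\Gamma\vdash^{(m,e)} t[x\leftarrow s]:M$; (ES) from $\Gamma,x:N\vdash^{(m,e)} t:M$ and $\Pi\vdash^{(m',e')} s:N$ with $N\neq\mathbf 0$ infer $\Gamma\uplus\Pi\vdash^{(m+m',e+e')} t[x\leftarrow s]:M$. A derivation of $\Gamma\vdash^{(m,e)} t:M$ is tight if $M=[\mathsf{normal}]$ and $\Gamma$ is empty. -}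

module Defs where

open import Data.Nat using (ℕ; zero; suc; _+_)
open import Data.Fin using (Fin; zero; suc)
open import Data.List using (List; []; _∷_; [_]; _++_)
open import Data.Vec using (Vec; []; _∷_; replicate; zipWith; _[_]≔_)
open import Data.List.Relation.Binary.Permutation.Homogeneous using (Permutation)
open import Relation.Binary.PropositionalEquality using (_≡_; _≢_)

private
  variable
    n k : ℕ

-- Terms (well-scoped de Bruijn; α-equivalence is syntactic identity).
-- Tm n = terms whose free variables are among n variables; Tm 0 = closed.

data Tm (n : ℕ) : Set where
  var : Fin n → Tm n
  lam : Tm (suc n) → Tm n
  app : Tm n → Tm n → Tm n
  es  : Tm (suc n) → Tm n → Tm n     -- es t s = t[x←s], x = var zero in t

ext : (Fin n → Fin k) → Fin (suc n) → Fin (suc k)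
ext ρ zero    = zero
ext ρ (suc i) = suc (ρ i)

rename : (Fin n → Fin k) → Tm n → Tm k
rename ρ (var i)   = var (ρ i)
rename ρ (lam t)   = lam (rename (ext ρ) t)
rename ρ (app t s) = app (rename ρ t) (rename ρ s)
rename ρ (es t s)  = es (rename (ext ρ) t) (rename ρ s)

-- CbNeed contexts  E ::= ⟨·⟩ | E t | E[x←t] | E⟨⟨x⟩⟩[x←E']
-- Ctx n : contexts whose outer scope has n variables.

data Ctx (n : ℕ) : Set where
  hole : Ctx n
  appL : Ctx n → Tm n → Ctx n
  esL  : Ctx (suc n) → Tm n → Ctx n
  esR  : Ctx (suc n) → Ctx n → Ctx n

scope : Ctx n → ℕ
scope {n} hole = n
scope (appL E _) = scope E
scope (esL E _)  = scope E
scope (esR _ E') = scope E'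

-- how outer variables are seen at the hole (E does not capture them)
emb : (E : Ctx n) → Fin n → Fin (scope E)
emb hole       i = i
emb (appL E _) i = emb E i
emb (esL E _)  i = emb E (suc i)
emb (esR _ E') i = emb E' i

-- E⟨t⟩ : plugging (may capture)
plug : (E : Ctx n) → Tm (scope E) → Tm n
plug hole       u = u
plug (appL E t) u = app (plug E u) t
plug (esL E t)  u = es (plug E u) t
plug (esR E E') u = es (plug E (var (emb E zero))) (plug E' u)

-- E⟨⟨t⟩⟩ : plugging without capture of the free variables of t
plugNC : (E : Ctx n) → Tm n → Tm n
plugNC E t = plug E (rename (emb E) t)

renCtx : (Fin n → Fin k) → Ctx n → Ctx k
renCtx ρ hole       = hole
renCtx ρ (appL E t) = appL (renCtx ρ E) (rename ρ t)
renCtx ρ (esL E t)  = esL (renCtx (ext ρ) E) (rename ρ t)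
renCtx ρ (esR E E') = esR (renCtx (ext ρ) E) (renCtx ρ E')

data SCtx (n : ℕ) : Set where
  shole : SCtx n
  sES   : SCtx (suc n) → Tm n → SCtx n

sscope : SCtx n → ℕ
sscope {n} shole = n
sscope (sES S _) = sscope S

semb : (S : SCtx n) → Fin n → Fin (sscope S)
semb shole     i = i
semb (sES S _) i = semb S (suc i)

splug : (S : SCtx n) → Tm (sscope S) → Tm n
splug shole     u = u
splug (sES S t) u = es (splug S u) t

-- Root steps.
-- m: S⟨λx.t⟩ s ↦ S⟨t[x←s]⟩   (s is not captured by S)
data _↦m_ {n : ℕ} : Tm n → Tm n → Set where
  rootm : (S : SCtx n) (t : Tm (suc (sscope S))) (s : Tm n) →
          app (splug S (lam t)) s ↦m splug S (es t (rename (semb S) s))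

-- e: E⟨⟨x⟩⟩[x←S⟨v⟩] ↦ S⟨E⟨⟨v⟩⟩[x←v]⟩   (S does not capture E⟨⟨x⟩⟩), v = λy.b
data _↦e_ {n : ℕ} : Tm n → Tm n → Set where
  roote : (E : Ctx (suc n)) (S : SCtx n) (b : Tm (suc (sscope S))) →
          es (plugNC E (var zero)) (splug S (lam b))
            ↦e splug S (es (plugNC (renCtx (ext (semb S)) E) (rename suc (lam b))) (lam b))

data _→m_ {n : ℕ} : Tm n → Tm n → Set where
  mctx : (E : Ctx n) {t s : Tm (scope E)} → t ↦m s → plug E t →m plug E s

data _→e_ {n : ℕ} : Tm n → Tm n → Set where
  ectx : (E : Ctx n) {t s : Tm (scope E)} → t ↦e s → plug E t →e plug E s

data _→need*_ {n : ℕ} : Tm n → Tm n → Set where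
  done   : {t : Tm n} → t →need* t
  m-step : {t u s : Tm n} → t →m u → u →need* s → t →need* s
  e-step : {t u s : Tm n} → t →e u → u →need* s → t →need* s

∣_∣m : {t s : Tm n} → t →need* s → ℕ
∣ done ∣m       = 0
∣ m-step _ d ∣m = suc ∣ d ∣m
∣ e-step _ d ∣m = ∣ d ∣m

∣_∣e : {t s : Tm n} → t →need* s → ℕ
∣ done ∣e       = 0
∣ m-step _ d ∣e = ∣ d ∣e
∣ e-step _ d ∣e = suc ∣ d ∣e

data normal {n : ℕ} : Tm n → Set where
  nlam : (t : Tm (suc n)) → normal (lam t)
  nes  : {t : Tm (suc n)} (s : Tm n) → normal t → normal (es t s)

-- CbNeed types.  Multisets are lists, considered up to (deep) permutation.

data LTy : Set where
  normalT : LTy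
  _⇒_    : List LTy → List LTy → LTy

MTy : Set
MTy = List LTy

data _≈ᴸ_ : LTy → LTy → Set where
  normalT : normalT ≈ᴸ normalT
  arr     : {M M' N N' : MTy} → Permutation _≈ᴸ_ M M' → Permutation _≈ᴸ_ N N' →
            (M ⇒ N) ≈ᴸ (M' ⇒ N')

_≈ᴹ_ : MTy → MTy → Set
M ≈ᴹ N = Permutation _≈ᴸ_ M N

TyCtx : ℕ → Set
TyCtx n = Vec MTy n

emptyCtx : TyCtx n
emptyCtx {n} = replicate n []

⦅_∶_⦆ : Fin n → MTy → TyCtx n
⦅ x ∶ M ⦆ = emptyCtx [ x ]≔ M

_⊎ᶜ_ : TyCtx n → TyCtx n → TyCtx n
Γ ⊎ᶜ Π = zipWith _++_ Γ Π

infix 4 _⊢ᴸ_∶_⟨_,_⟩ _⊢_∶_⟨_,_⟩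

mutual
  data _⊢ᴸ_∶_⟨_,_⟩ {n : ℕ} : TyCtx n → Tm n → LTy → ℕ → ℕ → Set where
    normalR : {t : Tm (suc n)} → emptyCtx ⊢ᴸ lam t ∶ normalT ⟨ 0 , 0 ⟩
    funR    : {Γ : TyCtx n} {M N : MTy} {t : Tm (suc n)} {m e : ℕ} →
              (M ∷ Γ) ⊢ t ∶ N ⟨ m , e ⟩ → Γ ⊢ᴸ lam t ∶ (M ⇒ N) ⟨ m , e ⟩

  data Many {n : ℕ} : TyCtx n → Tm n → MTy → ℕ → ℕ → Set where
    one  : {Γ : TyCtx n} {t : Tm n} {L : LTy} {m e : ℕ} →
           Γ ⊢ᴸ t ∶ L ⟨ m , e ⟩ → Many Γ t [ L ] m e
    more : {Γ Π : TyCtx n} {t : Tm n} {L : LTy} {M : MTy} {m e m' e' : ℕ} →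
           Γ ⊢ᴸ t ∶ L ⟨ m , e ⟩ → Many Π t M m' e' →
           Many (Γ ⊎ᶜ Π) t (L ∷ M) (m + m') (e + e')

  data _⊢_∶_⟨_,_⟩ {n : ℕ} : TyCtx n → Tm n → MTy → ℕ → ℕ → Set where
    ax    : {x : Fin n} {M : MTy} → M ≢ [] → ⦅ x ∶ M ⦆ ⊢ var x ∶ M ⟨ 0 , 1 ⟩
    many  : {Γ : TyCtx n} {t : Tm (suc n)} {M : MTy} {m e : ℕ} →
            Many Γ (lam t) M m e → Γ ⊢ lam t ∶ M ⟨ m , e ⟩
    appGc : {Γ : TyCtx n} {t s : Tm n} {M : MTy} {m e : ℕ} →
            Γ ⊢ t ∶ [ [] ⇒ M ] ⟨ m , e ⟩ → Γ ⊢ app t s ∶ M ⟨ m + 1 , e ⟩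
    appR  : {Γ Π : TyCtx n} {t s : Tm n} {M N N' : MTy} {m e m' e' : ℕ} →
            Γ ⊢ t ∶ [ N ⇒ M ] ⟨ m , e ⟩ → Π ⊢ s ∶ N' ⟨ m' , e' ⟩ →
            N ≈ᴹ N' → N ≢ [] →
            (Γ ⊎ᶜ Π) ⊢ app t s ∶ M ⟨ m + m' + 1 , e + e' ⟩
    esGc  : {Γ : TyCtx n} {t : Tm (suc n)} {s : Tm n} {M : MTy} {m e : ℕ} →
            ([] ∷ Γ) ⊢ t ∶ M ⟨ m , e ⟩ → Γ ⊢ es t s ∶ M ⟨ m , e ⟩
    esR   : {Γ Π : TyCtx n} {t : Tm (suc n)} {s : Tm n} {M N N' : MTy} {m e m' e' : ℕ} →
            (N ∷ Γ) ⊢ t ∶ M ⟨ m , e ⟩ → Π ⊢ s ∶ N' ⟨ m' , e' ⟩ →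
            N ≈ᴹ N' → N ≢ [] →
            (Γ ⊎ᶜ Π) ⊢ es t s ∶ M ⟨ m + m' , e + e' ⟩

Tight : {n : ℕ} → TyCtx n → Tm n → MTy → ℕ → ℕ → Set
Tight Γ t M m e = (Γ ≡ emptyCtx) × (M ≡ [ normalT ]) × (Γ ⊢ t ∶ M ⟨ m , e ⟩)
  where open import Data.Product using (_×_)

-- The proof is by subject expansion.  A normal form is typed [normal] in the
-- empty context at cost (0 , 0), and a derivation for the target of a
-- multiplicative (exponential) step under a CbNeed context can be turned into
-- one for its source with one more multiplicative (exponential) step counted.
-- Induction on the evaluation sequence d then types t with cost (|d|m , |d|e).
module Submission where

open import Defs
open import Data.Nat using (ℕ; zero; suc; _+_)
open import Data.Nat.Properties using (+-identityʳ; +-assoc)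
open import Data.Nat.Tactic.RingSolver using (solve-∀)
open import Data.Fin using (Fin; zero; suc)
open import Data.Fin.Properties using (suc-injective; _≟_)
open import Data.List using (List; []; _∷_; [_]; _++_)
open import Data.List.Properties using (++-conicalˡ; ++-conicalʳ; ++-assoc)
open import Data.Vec using (Vec; []; _∷_; lookup)
open import Data.Vec.Properties using (lookup-zipWith)
import Data.List.Relation.Binary.Permutation.Homogeneous as Perm
open import Data.List.Relation.Binary.Pointwise using (Pointwise; []; _∷_)
open import Data.Product using (Σ; _×_; _,_; proj₁; proj₂)
open import Data.Empty using (⊥; ⊥-elim)
open import Relation.Nullary using (yes; no)
open import Relation.Binary.Bundles using (Setoid)
open import Relation.Binary.PropositionalEquality
  using (_≡_; _≢_; refl; sym; trans; cong; cong₂; subst; subst₂)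
open import Function using (_∘_)
open import Function.Definitions using (Injective)
open import Algebra.Bundles using (CommutativeMonoid)
import Algebra.Construct.Pointwise as Pointwise
import Algebra.Properties.CommutativeSemigroup as CommSemigroupProperties
import Data.List.Relation.Binary.Permutation.Setoid as PermSetoid
import Data.List.Relation.Binary.Permutation.Setoid.Properties as PermProperties

private
  variable
    n k : ℕ

+-assoc₄ : ∀ a b c → a + b + c + 1 ≡ a + (b + c + 1)
+-assoc₄ = solve-∀

+-exchange : ∀ a b c → a + (b + c) ≡ b + (a + c)
+-exchange = solve-∀

-- Equality of types up to deep permutation (≈ᴸ, ≈ᴹ) is an equivalence;
-- reflexivity and symmetry must recurse through both the outer
-- permutation and the nested arrow types, hence the mutual definitions.
mutual
  ≈ᴸ-refl : ∀ L → L ≈ᴸ L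
  ≈ᴸ-refl normalT = normalT
  ≈ᴸ-refl (M ⇒ N) = arr (Perm.refl (≈ᴸ-refl* M)) (Perm.refl (≈ᴸ-refl* N))

  ≈ᴸ-refl* : ∀ M → Pointwise _≈ᴸ_ M M
  ≈ᴸ-refl* []      = []
  ≈ᴸ-refl* (L ∷ M) = ≈ᴸ-refl L ∷ ≈ᴸ-refl* M

mutual
  ≈ᴸ-sym : ∀ {L L'} → L ≈ᴸ L' → L' ≈ᴸ L
  ≈ᴸ-sym normalT   = normalT
  ≈ᴸ-sym (arr p q) = arr (≈ᴹ-sym p) (≈ᴹ-sym q)

  ≈ᴸ-sym* : ∀ {M N} → Pointwise _≈ᴸ_ M N → Pointwise _≈ᴸ_ N M
  ≈ᴸ-sym* []      = []
  ≈ᴸ-sym* (x ∷ p) = ≈ᴸ-sym x ∷ ≈ᴸ-sym* p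

  ≈ᴹ-sym : ∀ {M N} → M ≈ᴹ N → N ≈ᴹ M
  ≈ᴹ-sym (Perm.refl p)         = Perm.refl (≈ᴸ-sym* p)
  ≈ᴹ-sym (Perm.prep eq p)      = Perm.prep (≈ᴸ-sym eq) (≈ᴹ-sym p)
  ≈ᴹ-sym (Perm.swap eq₁ eq₂ p) = Perm.swap (≈ᴸ-sym eq₂) (≈ᴸ-sym eq₁) (≈ᴹ-sym p)
  ≈ᴹ-sym (Perm.trans p q)      = Perm.trans (≈ᴹ-sym q) (≈ᴹ-sym p)

≈ᴸ-trans : ∀ {L L' L''} → L ≈ᴸ L' → L' ≈ᴸ L'' → L ≈ᴸ L''
≈ᴸ-trans normalT   normalT     = normalT
≈ᴸ-trans (arr p q) (arr p' q') = arr (Perm.trans p p') (Perm.trans q q')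

LTy-setoid : Setoid _ _
LTy-setoid = record
  { Carrier       = LTy
  ; _≈_           = _≈ᴸ_
  ; isEquivalence = record { refl = ≈ᴸ-refl _ ; sym = ≈ᴸ-sym ; trans = ≈ᴸ-trans }
  }

open PermSetoid LTy-setoid using (↭-refl; ↭-sym; ↭-trans; ↭-reflexive)
open PermProperties LTy-setoid
  using (++⁺; ++⁺ˡ; ++⁺ʳ; ++-comm; ++-identityʳ; ++-commutativeMonoid)

≈ᴹ-[] : ∀ {M} → M ≈ᴹ [] → M ≡ []
≈ᴹ-[] (Perm.refl [])   = refl
≈ᴹ-[] (Perm.trans p q) with ≈ᴹ-[] q
... | refl = ≈ᴹ-[] p

≈ᴹ-nonempty : ∀ {M N} → M ≈ᴹ N → M ≢ [] → N ≢ []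
≈ᴹ-nonempty p M≢[] refl = M≢[] (≈ᴹ-[] p)

≈ᴹ-singleton : ∀ {M L} → M ≈ᴹ [ L ] → Σ LTy λ L' → (M ≡ [ L' ]) × (L' ≈ᴸ L)
≈ᴹ-singleton (Perm.refl (x ∷ []))  = _ , refl , x
≈ᴹ-singleton (Perm.prep eq p) with ≈ᴹ-[] p
... | refl = _ , refl , eq
≈ᴹ-singleton (Perm.trans p q) with ≈ᴹ-singleton q
... | _ , refl , e₁ with ≈ᴹ-singleton p
...   | _ , refl , e₂ = _ , refl , ≈ᴸ-trans e₂ e₁

-- Type contexts as functions.  Pointwise multiset union makes them a
-- commutative monoid (the power of the monoid of multi types), which
-- provides the context algebra used throughout.
Cx : ℕ → Set
Cx n = Fin n → MTy

cxMonoid : ℕ → CommutativeMonoid _ _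
cxMonoid n = Pointwise.commutativeMonoid (Fin n) ++-commutativeMonoid

module CxMonoid {n : ℕ} = CommutativeMonoid (cxMonoid n)
open CxMonoid using ()
  renaming ( _∙_ to infixr 6 _⊕_; _≈_ to infix 4 _≈ᶜ_; ε to ∅; refl to ≈ᶜ-refl; sym to ≈ᶜ-sym
           ; trans to ≈ᶜ-trans; ∙-cong to ⊕-cong; assoc to ⊕-assoc; comm to ⊕-comm
           ; identityʳ to ⊕-identityʳ)

module CxProperties {n : ℕ} = CommSemigroupProperties (CxMonoid.commutativeSemigroup {n})
open CxProperties using () renaming (xy∙z≈xz∙y to ⊕-swapʳ; xy∙z≈yz∙x to ⊕-rotate)

infixr 5 _∷ᶜ_

_∷ᶜ_ : MTy → Cx n → Cx (suc n)
(M ∷ᶜ Γ) zero    = M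
(M ∷ᶜ Γ) (suc i) = Γ i

single : Fin n → MTy → Cx n
single zero    M = M ∷ᶜ ∅
single (suc x) M = [] ∷ᶜ single x M

-- They differ from the official system only in
-- bookkeeping: contexts are functions, rule (many) is split into a binary
-- union (so multi types are built with _++_), and a conversion rule makes
-- derivability invariant under ≈ᶜ and ≈ᴹ.  Every flexible derivation gives an
-- official one (toOfficial), so subject expansion is proved here.
infix 4 _⊩_∶_⟨_,_⟩

data _⊩_∶_⟨_,_⟩ {n : ℕ} : Cx n → Tm n → MTy → ℕ → ℕ → Set where
  var-ax     : {x : Fin n} {M : MTy} → M ≢ [] → single x M ⊩ var x ∶ M ⟨ 0 , 1 ⟩
  abs-normal : {t : Tm (suc n)} → ∅ ⊩ lam t ∶ [ normalT ] ⟨ 0 , 0 ⟩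
  abs-fun    : {Γ : Cx n} {M N : MTy} {t : Tm (suc n)} {m e : ℕ} →
               M ∷ᶜ Γ ⊩ t ∶ N ⟨ m , e ⟩ → Γ ⊩ lam t ∶ [ M ⇒ N ] ⟨ m , e ⟩
  abs-union  : {Γ Π : Cx n} {t : Tm (suc n)} {M M' : MTy} {m e m' e' : ℕ} →
               Γ ⊩ lam t ∶ M ⟨ m , e ⟩ → Π ⊩ lam t ∶ M' ⟨ m' , e' ⟩ →
               Γ ⊕ Π ⊩ lam t ∶ M ++ M' ⟨ m + m' , e + e' ⟩
  app-gc     : {Γ : Cx n} {t s : Tm n} {M : MTy} {m e : ℕ} →
               Γ ⊩ t ∶ [ [] ⇒ M ] ⟨ m , e ⟩ → Γ ⊩ app t s ∶ M ⟨ m + 1 , e ⟩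
  app-arg    : {Γ Π : Cx n} {t s : Tm n} {M N : MTy} {m e m' e' : ℕ} →
               Γ ⊩ t ∶ [ N ⇒ M ] ⟨ m , e ⟩ → Π ⊩ s ∶ N ⟨ m' , e' ⟩ → N ≢ [] →
               Γ ⊕ Π ⊩ app t s ∶ M ⟨ m + m' + 1 , e + e' ⟩
  es-gc      : {Γ : Cx n} {t : Tm (suc n)} {s : Tm n} {M : MTy} {m e : ℕ} →
               [] ∷ᶜ Γ ⊩ t ∶ M ⟨ m , e ⟩ → Γ ⊩ es t s ∶ M ⟨ m , e ⟩
  es-arg     : {Γ Π : Cx n} {t : Tm (suc n)} {s : Tm n} {M N : MTy} {m e m' e' : ℕ} →
               N ∷ᶜ Γ ⊩ t ∶ M ⟨ m , e ⟩ → Π ⊩ s ∶ N ⟨ m' , e' ⟩ → N ≢ [] →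
               Γ ⊕ Π ⊩ es t s ∶ M ⟨ m + m' , e + e' ⟩
  conv       : {Γ Γ' : Cx n} {t : Tm n} {M M' : MTy} {m e : ℕ} →
               Γ ⊩ t ∶ M ⟨ m , e ⟩ → Γ ≈ᶜ Γ' → M ≈ᴹ M' → Γ' ⊩ t ∶ M' ⟨ m , e ⟩

private
  variable
    Γ Γ' Π   : Cx n
    t s      : Tm n
    M M' N   : MTy
    m e m' e' : ℕ

cast : Γ ⊩ t ∶ M ⟨ m , e ⟩ → m ≡ m' → e ≡ e' → Γ ⊩ t ∶ M ⟨ m' , e' ⟩
cast d refl refl = d

convᶜ : Γ ⊩ t ∶ M ⟨ m , e ⟩ → Γ ≈ᶜ Γ' → Γ' ⊩ t ∶ M ⟨ m , e ⟩
convᶜ d p = conv d p ↭-refl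

_≅_ : Vec MTy n → Cx n → Set
Γv ≅ Γ = ∀ i → lookup Γv i ≈ᴹ Γ i

Official : Cx n → Tm n → MTy → ℕ → ℕ → Set
Official {n} Γ t M m e =
  Σ (Vec MTy n) λ Γv → Γv ≅ Γ × Σ MTy λ M' → M' ≈ᴹ M × (Γv ⊢ t ∶ M' ⟨ m , e ⟩)

lookup-emptyCtx : (i : Fin n) → lookup (emptyCtx {n}) i ≡ []
lookup-emptyCtx zero    = refl
lookup-emptyCtx (suc i) = lookup-emptyCtx i

lookup-single : (x i : Fin n) (M : MTy) → lookup ⦅ x ∶ M ⦆ i ≡ single x M i
lookup-single zero    zero    M = refl
lookup-single zero    (suc i) M = lookup-emptyCtx i
lookup-single (suc x) zero    M = refl
lookup-single (suc x) (suc i) M = lookup-single x i M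

lookup-⊎ᶜ : (Γv Πv : Vec MTy n) (i : Fin n) → lookup (Γv ⊎ᶜ Πv) i ≈ᴹ (lookup Γv i ++ lookup Πv i)
lookup-⊎ᶜ Γv Πv i = ↭-reflexive (lookup-zipWith _++_ i Γv Πv)

-- Two (many)-families for the same abstraction concatenate into one; this
-- is the official counterpart of abs-union.
many-++ : {Γv Πv : Vec MTy n} → Many Γv t M m e → Many Πv t M' m' e' →
          Σ (Vec MTy n) λ Δv → (∀ i → lookup Δv i ≈ᴹ (lookup Γv i ++ lookup Πv i)) ×
                               Many Δv t (M ++ M') (m + m') (e + e')
many-++ {Γv = Γv} {Πv} (one d) ds = _ , lookup-⊎ᶜ Γv Πv , more d ds
many-++ {Πv = Πv'} (more {Γ = Γv} {Π = Πv} {m = m} {e} {m'} {e'} d ds) ds'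
  with many-++ ds ds'
... | Δv , r , ds'' =
  Γv ⊎ᶜ Δv , r' , subst₂ (Many (Γv ⊎ᶜ Δv) _ _) (sym (+-assoc m m' _)) (sym (+-assoc e e' _)) (more d ds'')
  where
  r' : ∀ i → lookup (Γv ⊎ᶜ Δv) i ≈ᴹ (lookup (Γv ⊎ᶜ Πv) i ++ lookup Πv' i)
  r' i = ↭-trans (lookup-⊎ᶜ Γv Δv i) (↭-trans (++⁺ˡ (lookup Γv i) (r i))
           (↭-trans (↭-reflexive (sym (++-assoc (lookup Γv i) (lookup Πv i) (lookup Πv' i))))
                    (++⁺ʳ (lookup Πv' i) (↭-sym (lookup-⊎ᶜ Γv Πv i)))))

toOfficial : Γ ⊩ t ∶ M ⟨ m , e ⟩ → Official Γ t M m e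
toOfficial (var-ax {x = x} {M} M≢[]) =
  ⦅ x ∶ M ⦆ , (λ i → ↭-reflexive (lookup-single x i M)) , M , ↭-refl , ax M≢[]
toOfficial abs-normal =
  emptyCtx , (λ i → ↭-reflexive (lookup-emptyCtx i)) , _ , ↭-refl , many (one normalR)
toOfficial (abs-fun d) with toOfficial d
... | (_ ∷ Γv) , r , _ , q , d' =
  Γv , r ∘ suc , _ , Perm.refl (arr (r zero) q ∷ []) , many (one (funR d'))
toOfficial (abs-union d₁ d₂) with toOfficial d₁ | toOfficial d₂
... | _ , r₁ , _ , q₁ , many ds₁ | _ , r₂ , _ , q₂ , many ds₂ with many-++ ds₁ ds₂
...   | Δv , r , ds = Δv , (λ i → ↭-trans (r i) (++⁺ (r₁ i) (r₂ i))) , _ , ++⁺ q₁ q₂ , many ds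
toOfficial (app-gc d) with toOfficial d
... | Γv , r , _ , q , d' with ≈ᴹ-singleton q
...   | _ , refl , arr p₁ p₂ with ≈ᴹ-[] p₁
...     | refl = Γv , r , _ , p₂ , appGc d'
toOfficial (app-arg d ds N≢[]) with toOfficial d | toOfficial ds
... | Γv , r₁ , _ , q₁ , d' | Πv , r₂ , _ , q₂ , ds' with ≈ᴹ-singleton q₁
...   | _ , refl , arr p₁ p₂ =
  Γv ⊎ᶜ Πv , (λ i → ↭-trans (lookup-⊎ᶜ Γv Πv i) (++⁺ (r₁ i) (r₂ i))) , _ , p₂ ,
  appR d' ds' (↭-trans p₁ (↭-sym q₂)) (≈ᴹ-nonempty (↭-sym p₁) N≢[])
toOfficial (es-gc d) with toOfficial d
... | (_ ∷ Γv) , r , _ , q , d' with ≈ᴹ-[] (r zero)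
...   | refl = Γv , r ∘ suc , _ , q , esGc d'
toOfficial (es-arg d ds N≢[]) with toOfficial d | toOfficial ds
... | (_ ∷ Γv) , r₁ , _ , q₁ , d' | Πv , r₂ , _ , q₂ , ds' =
  Γv ⊎ᶜ Πv , (λ i → ↭-trans (lookup-⊎ᶜ Γv Πv i) (++⁺ (r₁ (suc i)) (r₂ i))) , _ , q₁ ,
  esR d' ds' (↭-trans (r₁ zero) (↭-sym q₂)) (≈ᴹ-nonempty (↭-sym (r₁ zero)) N≢[])
toOfficial (conv d p q) with toOfficial d
... | Γv , r , _ , q' , d' = Γv , (λ i → ↭-trans (r i) (p i)) , _ , ↭-trans q' q , d'

Inj : (Fin n → Fin k) → Set
Inj ρ = Injective _≡_ _≡_ ρ

VanishesOff : (Fin n → Fin k) → Cx k → Set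
VanishesOff ρ Γ = ∀ j → (∀ i → ρ i ≢ j) → Γ j ≈ᴹ []

Pushforward : (Fin n → Fin k) → Cx n → Cx k → Set
Pushforward ρ A Y = (∀ i → Y (ρ i) ≈ᴹ A i) × VanishesOff ρ Y

pushforward-∅ : (ρ : Fin n → Fin k) → Pushforward ρ ∅ ∅
pushforward-∅ ρ = (λ i → ↭-refl) , (λ j _ → ↭-refl)

pushforward-∘suc : {ρ : Fin (suc n) → Fin k} → Inj ρ → {A : Cx n} {Y : Cx k} →
                   Pushforward (ρ ∘ suc) A Y → Pushforward ρ ([] ∷ᶜ A) Y
pushforward-∘suc {ρ = ρ} inj {A} {Y} (agree , vanish) = agree' , λ j off → vanish j (off ∘ suc)
  where
  agree' : ∀ i → Y (ρ i) ≈ᴹ ([] ∷ᶜ A) i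
  agree' zero    = vanish (ρ zero) (λ i eq → 0≢suc (inj eq))
    where 0≢suc : ∀ {i} → Fin.suc {n} i ≢ zero
          0≢suc ()
  agree' (suc i) = agree i

ext-inj : {ρ : Fin n → Fin k} → Inj ρ → Inj (ext ρ)
ext-inj inj {zero}  {zero}  eq = refl
ext-inj inj {suc i} {suc j} eq = cong suc (inj (suc-injective eq))

emb-inj : (E : Ctx n) → Inj (emb E)
emb-inj hole       eq = eq
emb-inj (appL E _) eq = emb-inj E eq
emb-inj (esL E _)  eq = suc-injective (emb-inj E eq)
emb-inj (esR _ E') eq = emb-inj E' eq

semb-inj : (S : SCtx n) → Inj (semb S)
semb-inj shole     eq = eq
semb-inj (sES S _) eq = suc-injective (semb-inj S eq)

single-self : (x : Fin n) (M : MTy) → single x M x ≡ M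
single-self zero    M = refl
single-self (suc x) M = single-self x M

single-other : (x j : Fin n) (M : MTy) → x ≢ j → single x M j ≡ []
single-other zero    zero    M x≢j = ⊥-elim (x≢j refl)
single-other zero    (suc j) M x≢j = refl
single-other (suc x) zero    M x≢j = refl
single-other (suc x) (suc j) M x≢j = single-other x j M (x≢j ∘ cong suc)

single-rename : {ρ : Fin n → Fin k} → Inj ρ → (x i : Fin n) (M : MTy) →
                single (ρ x) M (ρ i) ≡ single x M i
single-rename {ρ = ρ} inj x i M with x ≟ i
... | yes refl = trans (single-self (ρ x) M) (sym (single-self x M))
... | no x≢i   = trans (single-other (ρ x) (ρ i) M (x≢i ∘ inj)) (sym (single-other x i M x≢i))

single-pushforward : {ρ : Fin n → Fin k} → Inj ρ → (x : Fin n) (M : MTy) →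
                     Pushforward ρ (single x M) (single (ρ x) M)
single-pushforward {ρ = ρ} inj x M =
  (λ i → ↭-reflexive (single-rename inj x i M)) ,
  (λ j off → ↭-reflexive (single-other (ρ x) j M (off x)))

VanishesOff-⊕ : {ρ : Fin n → Fin k} → VanishesOff ρ Γ → VanishesOff ρ Π → VanishesOff ρ (Γ ⊕ Π)
VanishesOff-⊕ p q j off = ++⁺ (p j off) (q j off)

VanishesOff-ext : {ρ : Fin n → Fin k} {Γ : Cx (suc k)} → VanishesOff (ext ρ) Γ → VanishesOff ρ (Γ ∘ suc)
VanishesOff-ext p j off = p (suc j) λ { zero () ; (suc i) eq → off i (suc-injective eq) }

∷ᶜ-ext : {ρ : Fin n → Fin k} (M : MTy) (Γ : Cx k) → (M ∷ᶜ Γ) ∘ ext ρ ≈ᶜ M ∷ᶜ (Γ ∘ ρ)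
∷ᶜ-ext M Γ zero    = ↭-refl
∷ᶜ-ext M Γ (suc i) = ↭-refl

abs-nonempty : {b : Tm (suc n)} → Γ ⊩ lam b ∶ M ⟨ m , e ⟩ → M ≢ []
abs-nonempty abs-normal            ()
abs-nonempty (abs-fun d)           ()
abs-nonempty (abs-union d₁ d₂) eq  = abs-nonempty d₁ (++-conicalˡ _ _ eq)
abs-nonempty (conv d _ q)          = ≈ᴹ-nonempty q (abs-nonempty d)

var-nonempty : {y : Fin n} → Γ ⊩ var y ∶ M ⟨ m , e ⟩ → Γ y ≈ᴹ [] → ⊥
var-nonempty {y = y} (var-ax {M = M} M≢[]) p = M≢[] (trans (sym (single-self y M)) (≈ᴹ-[] p))
var-nonempty (conv d q _) p = var-nonempty d (↭-trans (q _) p)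

Strengthened : (Fin n → Fin k) → Cx k → Tm n → MTy → ℕ → ℕ → Set
Strengthened ρ Γ t M m e = (Γ ∘ ρ ⊩ t ∶ M ⟨ m , e ⟩) × VanishesOff ρ Γ

strengthened-conv : {ρ : Fin n → Fin k} {Γ Γ' : Cx k} →
                    Strengthened ρ Γ t M m e → Γ ≈ᶜ Γ' → M ≈ᴹ M' → Strengthened ρ Γ' t M' m e
strengthened-conv (d , vanish) p q = conv d (p ∘ _) q , λ j off → ↭-trans (↭-sym (p j)) (vanish j off)

strengthen : {ρ : Fin n → Fin k} → Inj ρ → {Γ : Cx k} (t : Tm n) →
             Γ ⊩ rename ρ t ∶ M ⟨ m , e ⟩ → Strengthened ρ Γ t M m e
strengthen {ρ = ρ} inj (var x) (var-ax {M = M} M≢[]) =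
  convᶜ (var-ax M≢[]) (λ i → ↭-reflexive (sym (single-rename inj x i M))) ,
  proj₂ (single-pushforward inj x M)
strengthen inj (lam t) abs-normal = abs-normal , λ j _ → ↭-refl
strengthen inj (lam t) (abs-fun {Γ = Γ} {M = M} d) with strengthen (ext-inj inj) t d
... | d' , vanish = abs-fun (convᶜ d' (∷ᶜ-ext M Γ)) , VanishesOff-ext vanish
strengthen inj (lam t) (abs-union d₁ d₂) with strengthen inj (lam t) d₁ | strengthen inj (lam t) d₂
... | d₁' , vanish₁ | d₂' , vanish₂ = abs-union d₁' d₂' , VanishesOff-⊕ vanish₁ vanish₂
strengthen inj (app t s) (app-gc d) with strengthen inj t d
... | d' , vanish = app-gc d' , vanish
strengthen inj (app t s) (app-arg d ds N≢[]) with strengthen inj t d | strengthen inj s ds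
... | d' , vanish₁ | ds' , vanish₂ = app-arg d' ds' N≢[] , VanishesOff-⊕ vanish₁ vanish₂
strengthen inj (es t s) (es-gc {Γ = Γ} d) with strengthen (ext-inj inj) t d
... | d' , vanish = es-gc (convᶜ d' (∷ᶜ-ext [] Γ)) , VanishesOff-ext vanish
strengthen inj (es t s) (es-arg {Γ = Γ} {N = N} d ds N≢[])
  with strengthen (ext-inj inj) t d | strengthen inj s ds
... | d' , vanish₁ | ds' , vanish₂ =
  es-arg (convᶜ d' (∷ᶜ-ext N Γ)) ds' N≢[] , VanishesOff-⊕ (VanishesOff-ext vanish₁) vanish₂
strengthen inj t (conv d p q) = strengthened-conv (strengthen inj t d) p q

renAtHole : (E : Ctx n) (ρ : Fin n → Fin k) → Fin (scope E) → Fin (scope (renCtx ρ E))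
renAtHole hole       ρ = ρ
renAtHole (appL E _) ρ = renAtHole E ρ
renAtHole (esL E _)  ρ = renAtHole E (ext ρ)
renAtHole (esR _ E') ρ = renAtHole E' ρ

renAtHole-emb : (E : Ctx n) (ρ : Fin n → Fin k) (i : Fin n) →
                renAtHole E ρ (emb E i) ≡ emb (renCtx ρ E) (ρ i)
renAtHole-emb hole       ρ i = refl
renAtHole-emb (appL E _) ρ i = renAtHole-emb E ρ i
renAtHole-emb (esL E _)  ρ i = renAtHole-emb E (ext ρ) (suc i)
renAtHole-emb (esR _ E') ρ i = renAtHole-emb E' ρ i

mutual
  plug-rename : (E : Ctx n) (ρ : Fin n → Fin k) (u : Tm (scope E)) →
                plug (renCtx ρ E) (rename (renAtHole E ρ) u) ≡ rename ρ (plug E u)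
  plug-rename hole       ρ u = refl
  plug-rename (appL E t) ρ u = cong (λ z → app z (rename ρ t)) (plug-rename E ρ u)
  plug-rename (esL E t)  ρ u = cong (λ z → es z (rename ρ t)) (plug-rename E (ext ρ) u)
  plug-rename (esR E E') ρ u = cong₂ es (plugNC-var-rename E (ext ρ) zero) (plug-rename E' ρ u)

  plugNC-var-rename : (E : Ctx n) (ρ : Fin n → Fin k) (x : Fin n) →
                      plugNC (renCtx ρ E) (var (ρ x)) ≡ rename ρ (plugNC E (var x))
  plugNC-var-rename E ρ x =
    trans (cong (plug (renCtx ρ E) ∘ var) (sym (renAtHole-emb E ρ x))) (plug-rename E ρ (var (emb E x)))

-- The right premise of (app)/(app_gc) and (ES)/(ES_gc): an argument is
-- either erased (multi type [], empty context, no cost) or genuinely typed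
-- with a non-empty multi type.
data Arg (Π : Cx n) (s : Tm n) : MTy → ℕ → ℕ → Set where
  erased : Π ≈ᶜ ∅ → Arg Π s [] 0 0
  used   : Π ⊩ s ∶ N ⟨ m , e ⟩ → N ≢ [] → Arg Π s N m e

⊕-erased : (Γ : Cx n) → Π ≈ᶜ ∅ → Γ ≈ᶜ Γ ⊕ Π
⊕-erased Γ Π≈∅ = ≈ᶜ-trans (≈ᶜ-sym (⊕-identityʳ Γ)) (⊕-cong (≈ᶜ-refl {x = Γ}) (≈ᶜ-sym Π≈∅))

es-opt : N ∷ᶜ Γ ⊩ t ∶ M ⟨ m , e ⟩ → Arg Π s N m' e' → Γ ⊕ Π ⊩ es t s ∶ M ⟨ m + m' , e + e' ⟩
es-opt {Γ = Γ} {m = m} {e} d (erased Π≈∅) =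
  cast (convᶜ (es-gc d) (⊕-erased Γ Π≈∅)) (sym (+-identityʳ m)) (sym (+-identityʳ e))
es-opt d (used ds N≢[]) = es-arg d ds N≢[]

app-opt : Γ ⊩ t ∶ [ N ⇒ M ] ⟨ m , e ⟩ → Arg Π s N m' e' →
          Γ ⊕ Π ⊩ app t s ∶ M ⟨ m + m' + 1 , e + e' ⟩
app-opt {Γ = Γ} {m = m} {e} d (erased Π≈∅) =
  cast (convᶜ (app-gc d) (⊕-erased Γ Π≈∅)) (cong (_+ 1) (sym (+-identityʳ m))) (sym (+-identityʳ e))
app-opt d (used ds N≢[]) = app-arg d ds N≢[]

abs-union-opt : {b : Tm (suc n)} → Γ ⊩ lam b ∶ M ⟨ m , e ⟩ → Arg Π (lam b) N m' e' →
                Γ ⊕ Π ⊩ lam b ∶ M ++ N ⟨ m + m' , e + e' ⟩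
abs-union-opt {Γ = Γ} {M = M} {m = m} {e} d (erased Π≈∅) =
  cast (conv d (⊕-erased Γ Π≈∅) (↭-sym (++-identityʳ M))) (sym (+-identityʳ m)) (sym (+-identityʳ e))
abs-union-opt d (used ds _) = abs-union d ds

arg-strengthen : {ρ : Fin n → Fin k} → Inj ρ → {Π : Cx k} (s : Tm n) →
                 Arg Π (rename ρ s) N m e → Arg (Π ∘ ρ) s N m e × VanishesOff ρ Π
arg-strengthen inj s (erased Π≈∅) = erased (Π≈∅ ∘ _) , λ j _ → Π≈∅ j
arg-strengthen inj s (used ds N≢[]) with strengthen inj s ds
... | ds' , vanish = used ds' N≢[] , vanish

data ESView (Γ : Cx n) (t : Tm (suc n)) (s : Tm n) (M : MTy) : ℕ → ℕ → Set where
  esView : (N : MTy) (Γt Π : Cx n) → N ∷ᶜ Γt ⊩ t ∶ M ⟨ m , e ⟩ → Arg Π s N m' e' →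
           Γ ≈ᶜ Γt ⊕ Π → ESView Γ t s M (m + m') (e + e')

es-inv : Γ ⊩ es t s ∶ M ⟨ m , e ⟩ → ESView Γ t s M m e
es-inv {Γ = Γ} (es-gc {m = m} {e} d) =
  subst₂ (ESView Γ _ _ _) (+-identityʳ m) (+-identityʳ e)
    (esView [] Γ ∅ d (erased ≈ᶜ-refl) (≈ᶜ-sym (⊕-identityʳ Γ)))
es-inv (es-arg {Γ = Γ} {Π} d ds N≢[]) = esView _ Γ Π d (used ds N≢[]) ≈ᶜ-refl
es-inv (conv d p q) with es-inv d
... | esView N Γt Π dt ds split = esView N Γt Π (conv dt ≈ᶜ-refl q) ds (≈ᶜ-trans (≈ᶜ-sym p) split)

data AppView (Γ : Cx n) (t s : Tm n) (M : MTy) : ℕ → ℕ → Set where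
  appView : (N : MTy) (Γt Π : Cx n) → Γt ⊩ t ∶ [ N ⇒ M ] ⟨ m , e ⟩ → Arg Π s N m' e' →
            Γ ≈ᶜ Γt ⊕ Π → AppView Γ t s M (m + m' + 1) (e + e')

app-inv : Γ ⊩ app t s ∶ M ⟨ m , e ⟩ → AppView Γ t s M m e
app-inv {Γ = Γ} (app-gc {m = m} {e} d) =
  subst₂ (AppView Γ _ _ _) (cong (_+ 1) (+-identityʳ m)) (+-identityʳ e)
    (appView [] Γ ∅ d (erased ≈ᶜ-refl) (≈ᶜ-sym (⊕-identityʳ Γ)))
app-inv (app-arg {Γ = Γ} {Π} d ds N≢[]) = appView _ Γ Π d (used ds N≢[]) ≈ᶜ-refl
app-inv (conv d p q) with app-inv d
... | appView N Γt Π dt ds split =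
  appView N Γt Π (conv dt ≈ᶜ-refl (Perm.refl (arr ↭-refl q ∷ []))) ds (≈ᶜ-trans (≈ᶜ-sym p) split)

-- A typing of a substitution context S: it turns a term typed in Γin at
-- the hole into one typed in Γout, adding the costs (m , e) of the
-- substituted arguments.
data SubstDer : (S : SCtx n) → Cx (sscope S) → Cx n → ℕ → ℕ → Set where
  at-hole : {Γin Γout : Cx n} → Γin ≈ᶜ Γout → SubstDer shole Γin Γout 0 0
  at-es   : {S : SCtx (suc n)} {r : Tm n} {Γin : Cx (sscope S)} {Γ Π Γout : Cx n} →
            SubstDer S Γin (N ∷ᶜ Γ) m e → Arg Π r N m' e' → Γout ≈ᶜ Γ ⊕ Π →
            SubstDer (sES S r) Γin Γout (m + m') (e + e')

data SubstView (S : SCtx n) (Γ : Cx n) (X : Tm (sscope S)) (M : MTy) : ℕ → ℕ → Set where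
  substView : (Γin : Cx (sscope S)) → Γin ⊩ X ∶ M ⟨ m , e ⟩ → SubstDer S Γin Γ m' e' →
              SubstView S Γ X M (m + m') (e + e')

subst-inv : (S : SCtx n) {X : Tm (sscope S)} → Γ ⊩ splug S X ∶ M ⟨ m , e ⟩ → SubstView S Γ X M m e
subst-inv {Γ = Γ} {m = m} {e = e} shole d =
  subst₂ (SubstView shole Γ _ _) (+-identityʳ m) (+-identityʳ e) (substView Γ d (at-hole ≈ᶜ-refl))
subst-inv {Γ = Γ} (sES S r) d with es-inv d
... | esView N Γt Π dt ds split with subst-inv S dt
...   | substView {m = mx} {ex} {ms} {eₛ} Γin dX sd =
  subst₂ (SubstView (sES S r) Γ _ _) (sym (+-assoc mx ms _)) (sym (+-assoc ex eₛ _))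
    (substView Γin dX (at-es sd ds split))

subst-plug : {S : SCtx n} {Γin : Cx (sscope S)} {X : Tm (sscope S)} →
             SubstDer S Γin Γ m' e' → Γin ⊩ X ∶ M ⟨ m , e ⟩ → Γ ⊩ splug S X ∶ M ⟨ m + m' , e + e' ⟩
subst-plug {m = m} {e = e} (at-hole p) d = cast (convᶜ d p) (sym (+-identityʳ m)) (sym (+-identityʳ e))
subst-plug {m = m} {e = e} (at-es {m = ms} {eₛ} {ms'} {eₛ'} sd ds split) d =
  cast (convᶜ (es-opt (subst-plug sd d) ds) (≈ᶜ-sym split)) (+-assoc m ms ms') (+-assoc e eₛ eₛ')

subst-der-conv : {S : SCtx n} {Γin : Cx (sscope S)} →
                 SubstDer S Γin Γ m e → Γ ≈ᶜ Γ' → SubstDer S Γin Γ' m e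
subst-der-conv (at-hole p)         q = at-hole (≈ᶜ-trans p q)
subst-der-conv (at-es sd ds split) q = at-es sd ds (≈ᶜ-trans (≈ᶜ-sym q) split)

-- The part Y of the hole context that concerns variables bound outside S
-- (the push-forward of some B) can be pulled out of the typing of S.
subst-pull : {S : SCtx n} {Γin A Y : Cx (sscope S)} {B : Cx n} →
             SubstDer S Γin Γ m e → Γin ≈ᶜ A ⊕ Y → Pushforward (semb S) B Y →
             Σ (Cx n) λ Γ' → SubstDer S A Γ' m e × Γ ≈ᶜ Γ' ⊕ B
subst-pull {A = A} (at-hole p) split (agree , _) =
  A , at-hole ≈ᶜ-refl , ≈ᶜ-trans (≈ᶜ-sym p) (≈ᶜ-trans split (⊕-cong (≈ᶜ-refl {x = A}) agree))
subst-pull {S = sES S r} {B = B} (at-es {N = N} {Γ = Γ} {Π} sd ds split') split push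
  with subst-pull sd split (pushforward-∘suc (semb-inj S) push)
... | Γ'' , sd' , rel =
  (Γ'' ∘ suc) ⊕ Π , at-es (subst-der-conv sd' head) ds ≈ᶜ-refl ,
  ≈ᶜ-trans split' (≈ᶜ-trans (⊕-cong (rel ∘ suc) (≈ᶜ-refl {x = Π})) (⊕-swapʳ (Γ'' ∘ suc) B Π))
  where
  -- the pulled-out part B does not concern the variable bound by r
  head : Γ'' ≈ᶜ N ∷ᶜ (Γ'' ∘ suc)
  head zero    = ↭-sym (↭-trans (rel zero) (++-identityʳ (Γ'' zero)))
  head (suc i) = ↭-refl

absent-⊕ : {Γ₁ Γ₂ : Cx n} (x : Fin n) → Γ ≈ᶜ Γ₁ ⊕ Γ₂ → Γ x ≈ᴹ [] → Γ₁ x ≈ᴹ [] × Γ₂ x ≈ᴹ []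
absent-⊕ {Γ₁ = Γ₁} {Γ₂} x split empty =
  ↭-reflexive (++-conicalˡ (Γ₁ x) (Γ₂ x) eq) , ↭-reflexive (++-conicalʳ (Γ₁ x) (Γ₂ x) eq)
  where eq = ≈ᴹ-[] (↭-trans (↭-sym (split x)) empty)

≈ᴹ-++[] : {A B : MTy} → (A ++ []) ≈ᴹ (B ++ []) → A ≈ᴹ B
≈ᴹ-++[] {A} {B} p = ↭-trans (↭-sym (++-identityʳ A)) (↭-trans p (++-identityʳ B))

hole-var-needed : (E : Ctx n) (x : Fin n) → Γ ⊩ plugNC E (var x) ∶ M ⟨ m , e ⟩ → Γ x ≈ᴹ [] → ⊥
hole-var-needed hole x d empty = var-nonempty d empty
hole-var-needed (appL E r) x d empty with app-inv d
... | appView N Γt Π dt ds split =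
  hole-var-needed E x dt (proj₁ (absent-⊕ {Γ₁ = Γt} {Π} x split empty))
hole-var-needed (esL E r) x d empty with es-inv d
... | esView N Γt Π dt ds split =
  hole-var-needed E (suc x) dt (proj₁ (absent-⊕ {Γ₁ = Γt} {Π} x split empty))
hole-var-needed (esR E E') x d empty with es-inv d
... | esView N Γt Π dt (erased _) split = hole-var-needed E zero dt ↭-refl
... | esView N Γt Π dt (used ds _) split =
  hole-var-needed E' x ds (proj₂ (absent-⊕ {Γ₁ = Γt} {Π} x split empty))

-- Suppose E⟨X⟩ is typed in Γ with X typed K in
-- Θ at cost (m , e) and the rest of the derivation costing (mE , eE).  Then
-- any X' typed K in a context Θ' that differs from Θ only on variables
-- bound outside E (Θ' ⊕ Ya ≈ Θ ⊕ Yb, with Ya, Yb push-forwards of A, B)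
-- can replace X, with the corresponding change of the outer context.
Refill : (E : Ctx n) → Cx n → Cx (scope E) → MTy → MTy → ℕ → ℕ → Set
Refill {n} E Γ Θ K M mE eE =
  ∀ {Θ' : Cx (scope E)} {X' : Tm (scope E)} {m e} {A B : Cx n} {Ya Yb : Cx (scope E)} →
  Θ' ⊕ Ya ≈ᶜ Θ ⊕ Yb → Pushforward (emb E) A Ya → Pushforward (emb E) B Yb →
  Θ' ⊩ X' ∶ K ⟨ m , e ⟩ →
  Σ (Cx n) λ Γ' → Γ' ⊕ A ≈ᶜ Γ ⊕ B × Γ' ⊩ plug E X' ∶ M ⟨ m + mE , e + eE ⟩

refill-conv : {E : Ctx n} {Θ : Cx (scope E)} {K : MTy} {mE eE : ℕ} →
              Refill E Γ Θ K M mE eE → Γ ≈ᶜ Γ' → Refill E Γ' Θ K M mE eE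
refill-conv refill p q pa pb d with refill q pa pb d
... | G , rel , d' = G , ≈ᶜ-trans rel (⊕-cong p ≈ᶜ-refl) , d'

refill-hole : Refill hole Γ Γ M M 0 0
refill-hole {Γ = Γ} {Θ' = Θ'} {m = m} {e = e} q (agreeA , _) (agreeB , _) d =
  Θ' ,
  ≈ᶜ-trans (⊕-cong (≈ᶜ-refl {x = Θ'}) (≈ᶜ-sym agreeA)) (≈ᶜ-trans q (⊕-cong (≈ᶜ-refl {x = Γ}) agreeB)) ,
  cast d (sym (+-identityʳ m)) (sym (+-identityʳ e))

refill-appL : {E : Ctx n} {r : Tm n} {Θ : Cx (scope E)} {K : MTy} {mE eE : ℕ} →
              Refill E Γ Θ K [ N ⇒ M ] mE eE → Arg Π r N m' e' →
              Refill (appL E r) (Γ ⊕ Π) Θ K M (mE + m' + 1) (eE + e')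
refill-appL {Γ = Γ} {Π = Π} {m' = m'} {e' = e'} {mE = mE} {eE = eE} refill ds
            {m = m} {e = e} {A = A} {B = B} q pa pb d
  with refill q pa pb d
... | G , rel , d' =
  G ⊕ Π ,
  ≈ᶜ-trans (⊕-swapʳ G Π A) (≈ᶜ-trans (⊕-cong rel (≈ᶜ-refl {x = Π})) (⊕-swapʳ Γ B Π)) ,
  cast (app-opt d' ds) (+-assoc₄ m mE m') (+-assoc e eE e')

refill-esL : {E : Ctx (suc n)} {r : Tm n} {Θ : Cx (scope E)} {K : MTy} {mE eE : ℕ} →
             Refill E (N ∷ᶜ Γ) Θ K M mE eE → Arg Π r N m' e' →
             Refill (esL E r) (Γ ⊕ Π) Θ K M (mE + m') (eE + e')
refill-esL {N = N} {Γ = Γ} {Π = Π} {m' = m'} {e' = e'} {E = E} {mE = mE} {eE = eE} refill ds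
           {m = m} {e = e} {A = A} {B = B} q pa pb d
  with refill q (pushforward-∘suc (emb-inj E) pa) (pushforward-∘suc (emb-inj E) pb) d
... | G , rel , d' =
  (G ∘ suc) ⊕ Π ,
  ≈ᶜ-trans (⊕-swapʳ (G ∘ suc) Π A) (≈ᶜ-trans (⊕-cong (rel ∘ suc) (≈ᶜ-refl {x = Π})) (⊕-swapʳ Γ B Π)) ,
  cast (es-opt (convᶜ d' head) ds) (+-assoc m mE m') (+-assoc e eE e')
  where
  -- the outer change does not concern the variable bound by r
  head : G ≈ᶜ N ∷ᶜ (G ∘ suc)
  head zero    = ≈ᴹ-++[] (rel zero)
  head (suc i) = ↭-refl

refill-esR : {E : Ctx (suc n)} {E' : Ctx n} {Θ : Cx (scope E')} {K : MTy} {mE eE : ℕ} →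
             N ∷ᶜ Γ ⊩ plugNC E (var zero) ∶ M ⟨ m' , e' ⟩ → N ≢ [] →
             Refill E' Π Θ K N mE eE →
             Refill (esR E E') (Γ ⊕ Π) Θ K M (m' + mE) (e' + eE)
refill-esR {Γ = Γ} {m' = m'} {e' = e'} {Π = Π} {mE = mE} {eE = eE} dt N≢[] refill
           {m = m} {e = e} {A = A} {B = B} q pa pb d
  with refill q pa pb d
... | G , rel , d' =
  Γ ⊕ G ,
  ≈ᶜ-trans (⊕-assoc Γ G A) (≈ᶜ-trans (⊕-cong (≈ᶜ-refl {x = Γ}) rel) (≈ᶜ-sym (⊕-assoc Γ Π B))) ,
  cast (es-arg dt d' N≢[]) (+-exchange m' m mE) (+-exchange e' e eE)

data Decomp (E : Ctx n) (Γ : Cx n) (X : Tm (scope E)) (M : MTy) : ℕ → ℕ → Set where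
  decomp : (Θ : Cx (scope E)) (K : MTy) → Θ ⊩ X ∶ K ⟨ m , e ⟩ → Refill E Γ Θ K M m' e' →
           Decomp E Γ X M (m + m') (e + e')

decompose : (E : Ctx n) {X : Tm (scope E)} → Γ ⊩ plug E X ∶ M ⟨ m , e ⟩ → Decomp E Γ X M m e
decompose {Γ = Γ} {M = M} {m = m} {e = e} hole d =
  subst₂ (Decomp hole Γ _ M) (+-identityʳ m) (+-identityʳ e) (decomp Γ M d refill-hole)
decompose {Γ = Γ} (appL E r) d with app-inv d
... | appView N Γt Π dt ds split with decompose E dt
...   | decomp {m = mX} {eX} {mE} {eE} Θ K dX refill =
  subst₂ (Decomp (appL E r) Γ _ _) (sym (+-assoc₄ mX mE _)) (sym (+-assoc eX eE _))
    (decomp Θ K dX (refill-conv {E = appL E r} (refill-appL refill ds) (≈ᶜ-sym split)))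
decompose {Γ = Γ} (esL E r) d with es-inv d
... | esView N Γt Π dt ds split with decompose E dt
...   | decomp {m = mX} {eX} {mE} {eE} Θ K dX refill =
  subst₂ (Decomp (esL E r) Γ _ _) (sym (+-assoc mX mE _)) (sym (+-assoc eX eE _))
    (decomp Θ K dX (refill-conv {E = esL E r} (refill-esL refill ds) (≈ᶜ-sym split)))
decompose {Γ = Γ} (esR E E') d with es-inv d
... | esView N Γt Π dt (erased _) split = ⊥-elim (hole-var-needed E zero dt ↭-refl)
... | esView {m = mt} {e = et} N Γt Π dt (used ds N≢[]) split with decompose E' ds
...   | decomp {m = mX} {eX} {mE} {eE} Θ K dX refill =
  subst₂ (Decomp (esR E E') Γ _ _) (+-exchange mX mt mE) (+-exchange eX et eE)
    (decomp Θ K dX (refill-conv {E = esR E E'} (refill-esR dt N≢[] refill) (≈ᶜ-sym split)))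

Expands : ℕ → ℕ → Tm n → Tm n → Set
Expands {n} δm δe t u =
  ∀ {Γ : Cx n} {M m e} → Γ ⊩ u ∶ M ⟨ m , e ⟩ → Γ ⊩ t ∶ M ⟨ δm + m , δe + e ⟩

-- Multiplicative root step S⟨λx.t⟩ s ↦ S⟨t[x←s]⟩: the argument s, typed
-- inside S, is pulled out of S and applied.
root-m-expands : {t u : Tm n} → t ↦m u → Expands 1 0 t u
root-m-expands (rootm S t s) d with subst-inv S d
... | substView {m' = ms} {e' = eₛ} Γin dX sd with es-inv dX
...   | esView {m = mt} {e = et} {m' = ma} {e' = ea} N Γt Π dt ds split
  with arg-strengthen (semb-inj S) s ds
...     | ds' , vanish with subst-pull sd split ((λ i → ↭-refl) , vanish)
...       | Γ' , sd' , rel =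
  cast (convᶜ (app-opt (subst-plug sd' (abs-fun dt)) ds') (≈ᶜ-sym rel))
       (rearrange-m mt ms ma) (rearrange-e et eₛ ea)
  where
  rearrange-m : ∀ a b c → a + b + c + 1 ≡ 1 + (a + c + b)
  rearrange-m = solve-∀
  rearrange-e : ∀ a b c → a + b + c ≡ a + c + b
  rearrange-e = solve-∀

-- Reverting the substitution of an abstraction λb for the variable x at the
-- hole of E: a typing of E⟨⟨λb⟩⟩ splits into a typing of E⟨⟨x⟩⟩, in
-- which x receives the type K of that occurrence, and a typing of λb with
-- type K; the extra exponential step accounts for the axiom on x.
data Unshared (E : Ctx (suc n)) (b : Tm (suc n)) (Γ : Cx (suc n)) (M : MTy) : ℕ → ℕ → Set where
  unshared : (K : MTy) (Δ : Cx n) (Γ' : Cx (suc n)) →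
             Γ' ⊩ plugNC E (var zero) ∶ M ⟨ m , suc e ⟩ → Δ ⊩ lam b ∶ K ⟨ m' , e' ⟩ →
             Γ' ⊕ ([] ∷ᶜ Δ) ≈ᶜ Γ ⊕ single zero K → Unshared E b Γ M (m' + m) (e' + e)

unshare : (E : Ctx (suc n)) (b : Tm (suc n)) →
          Γ ⊩ plugNC E (rename suc (lam b)) ∶ M ⟨ m , e ⟩ → Unshared E b Γ M m e
unshare E b d with decompose E d
... | decomp Θ K dV refill with strengthen (emb-inj E) (rename suc (lam b)) dV
...   | dV' , vanish with strengthen suc-injective (lam b) dV'
...     | dB , vanish' with refill (⊕-comm (single (emb E zero) K) Θ) ((λ i → ↭-refl) , vanish)
                                   (single-pushforward (emb-inj E) zero K) (var-ax (abs-nonempty dB))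
...       | Γ' , rel , dP = unshared K (Θ ∘ emb E ∘ suc) Γ' dP dB (≈ᶜ-trans (⊕-cong ≈ᶜ-refl head) rel)
  where
  -- the occurrence of λb does not mention x, the variable it is substituted for
  head : [] ∷ᶜ (Θ ∘ emb E ∘ suc) ≈ᶜ Θ ∘ emb E
  head zero    = ↭-sym (vanish' zero (λ i ()))
  head (suc i) = ↭-refl

unshared-split : {Γin Γt Π Δ : Cx n} {Γ' : Cx (suc n)} {K : MTy} →
                 Γin ≈ᶜ Γt ⊕ Π → Γ' ⊕ ([] ∷ᶜ Δ) ≈ᶜ (N ∷ᶜ Γt) ⊕ single zero K →
                 Γin ≈ᶜ (Δ ⊕ Π) ⊕ (Γ' ∘ suc)
unshared-split {Γt = Γt} {Π} {Δ} {Γ'} split rel =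
  ≈ᶜ-trans split (≈ᶜ-trans (⊕-cong body (≈ᶜ-refl {x = Π})) (⊕-rotate (Γ' ∘ suc) Δ Π))
  where
  body : Γt ≈ᶜ (Γ' ∘ suc) ⊕ Δ
  body i = ↭-sym (↭-trans (rel (suc i)) (++-identityʳ (Γt i)))

-- Exponential root step E⟨⟨x⟩⟩[x←S⟨v⟩] ↦ S⟨E⟨⟨v⟩⟩[x←v]⟩: the copy of v
-- at the hole is turned back into x, its type joins that of the substituted
-- v, and the substitution is moved out of S.
root-e-expands : {t u : Tm n} → t ↦e u → Expands 0 1 t u
root-e-expands (roote E S b) d with subst-inv S d
... | substView {m' = ms} {e' = eₛ} Γin dX sd with es-inv dX
...   | esView {m' = ma} {e' = ea} N Γt Π dQ arg split with unshare (renCtx (ext (semb S)) E) b dQ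
...     | unshared {m = mP} {e = eP} {m' = mB} {e' = eB} K Δ Γ' dP dB rel
  with strengthen (ext-inj (semb-inj S)) (plugNC E (var zero))
         (subst (λ z → Γ' ⊩ z ∶ _ ⟨ _ , _ ⟩) (plugNC-var-rename E (ext (semb S)) zero) dP)
...       | dP' , vanish
  with subst-pull sd (unshared-split split rel) ((λ i → ↭-refl) , VanishesOff-ext vanish)
...         | Γ'' , sd' , rel' =
  cast (convᶜ (es-arg (convᶜ dP' head) (subst-plug sd' (abs-union-opt dB arg)) KN≢[])
              (≈ᶜ-trans (⊕-comm (Γ' ∘ suc ∘ semb S) Γ'') (≈ᶜ-sym rel')))
       (rearrange mB mP ma ms) (cong suc (rearrange eB eP ea eₛ))
  where
  -- x now receives the types of both the copy of v and the substituted v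
  head : Γ' ∘ ext (semb S) ≈ᶜ (K ++ N) ∷ᶜ (Γ' ∘ suc ∘ semb S)
  head zero    = ↭-trans (↭-sym (++-identityʳ (Γ' zero))) (↭-trans (rel zero) (++-comm N K))
  head (suc i) = ↭-refl
  KN≢[] : K ++ N ≢ []
  KN≢[] eq = abs-nonempty dB (++-conicalˡ K N eq)
  rearrange : ∀ a b c d → b + ((a + c) + d) ≡ ((a + b) + c) + d
  rearrange = solve-∀

-- Expansion is preserved by CbNeed contexts: decompose, expand the hole,
-- and refill with an unchanged context.
expands-in-context : {δm δe : ℕ} (E : Ctx n) {t u : Tm (scope E)} →
                     Expands δm δe t u → Expands δm δe (plug E t) (plug E u)
expands-in-context {δm = δm} {δe} E root d with decompose E d
... | decomp {m = mX} {eX} {mE} {eE} Θ K dX refill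
  with refill (≈ᶜ-refl {x = Θ ⊕ ∅}) (pushforward-∅ (emb E)) (pushforward-∅ (emb E)) (root dX)
...   | Γ' , rel , d' =
  cast (convᶜ d' (≈ᶜ-trans (≈ᶜ-sym (⊕-identityʳ Γ')) (≈ᶜ-trans rel (⊕-identityʳ _))))
       (+-assoc δm mX mE) (+-assoc δe eX eE)

normal-typed : {s : Tm n} → normal s → ∅ ⊩ s ∶ [ normalT ] ⟨ 0 , 0 ⟩
normal-typed (nlam t)  = abs-normal
normal-typed (nes s p) = es-gc (convᶜ (normal-typed p) λ { zero → ↭-refl ; (suc i) → ↭-refl })

expand : {t s : Tm n} (d : t →need* s) → normal s → ∅ ⊩ t ∶ [ normalT ] ⟨ ∣ d ∣m , ∣ d ∣e ⟩
expand done                    ns = normal-typed ns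
expand (m-step (mctx E r) d) ns = expands-in-context E (root-m-expands r) (expand d ns)
expand (e-step (ectx E r) d) ns = expands-in-context E (root-e-expands r) (expand d ns)

-- For closed terms the official derivation has the empty context, and a
-- type equivalent to [normal] is [normal].
theorem6 : (t s : Tm 0) (d : t →need* s) → normal s →
    Tight [] t (normalT ∷ []) ∣ d ∣m ∣ d ∣e
theorem6 t s d ns with toOfficial (expand d ns)
... | [] , _ , _ , [normal] , der with ≈ᴹ-singleton [normal]
...   | _ , refl , normalT = refl , refl , der
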